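{- Let $(C,\phi)$ be a multistate monotone system, let $k\in\{1,\ldots,M\}$, let $\mathfrak{P}_k$ be the set of minimal $k$-level path vectors and $\delta_k$ the signed domination function of $\mathrm{cl}(\mathfrak{P}_k)$. Then $$\phi_k(\bm{y})=\sum_{\bm{x}\in\mathrm{cl}(\mathfrak{P}_k),\ \bm{x}\le\bm{y}}\delta_k(\bm{x})\quad\text{for all }\bm{y}\in\mathrm{cl}(\mathfrak{P}_k).$$
   Context: A multistate monotone system (MMS) $(C,\phi)$ has component set $C=\{1,\ldots,n\}$, component state sets $\mathcal{S}_i=\{0,1,\ldots,m_i\}$, component state space $\mathfrak{C}=\mathcal{S}_1\times\cdots\times\mathcal{S}_n$, system state set $\{0,1,\ldots,M\}$, and a structure function $\phi:\mathfrak{C}\to\{0,\ldots,M\}$ non-decreasing in each argument. The $k$-level structure function is $\phi_k(\bm{x})=\mathrm{I}(\phi(\bm{x})\ge k)$. Vectors are ordered componentwise. A minimal $k$-level path vector is $\bm{x}\in\mathfrak{C}$ with $\phi(\bm{x})\ge k$ and $\phi(\bm{y})<k$ for all $\bm{y}\in\mathfrak{C}$ with $\bm{y}\le\bm{x}$, $\bm{y}\neq\bm{x}$. For a set $\mathfrak{X}$ of pairwise incomparable vectors, $\mathrm{cl}(\mathfrak{X})$ is the smallest set containing $\mathfrak{X}$ closed under componentwise maximum $\vee$. A formation of $\bm{x}\in\mathrm{cl}(\mathfrak{X})$ is a nonempty subset $\{\bm{x}_{i_1},\ldots,\bm{x}_{i_j}\}\subseteq\mathfrak{X}$ with $\bm{x}=\bm{x}_{i_1}\vee\cdots\vee\bm{x}_{i_j}$,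 odd or even according to the parity of $j$; the signed domination function is $\delta(\bm{x})=$ (number of odd formations) $-$ (number of even formations). -}

module Defs where

open import Data.Nat as ℕ using (ℕ; zero; suc; _≤_; _<_; _⊔_; _≤?_; _<?_)
open import Data.Nat.Properties as ℕP using ()
open import Data.Vec as V using (Vec; []; _∷_; zipWith; replicate)
open import Data.Vec.Properties using (≡-dec)
open import Data.Vec.Relation.Binary.Pointwise.Inductive as PW using (Pointwise)
open import Data.List as L using (List; []; _∷_; map; concatMap; filter; foldr; length; upTo; deduplicate)
open import Data.List.Relation.Unary.All as All using (All; all?)
open import Data.List.Membership.Propositional using (_∈_)
open import Data.Product using (_×_; Σ-syntax)
open import Data.Integer as ℤ using (ℤ; +_)
open import Relation.Binary.PropositionalEquality using (_≡_; _≢_)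
open import Relation.Nullary using (Dec; yes; no; ¬_)
open import Relation.Nullary.Decidable using (_×-dec_; _→-dec_; ¬?)

_≤v_ : ∀ {n} → Vec ℕ n → Vec ℕ n → Set
x ≤v y = Pointwise _≤_ x y

_≤v?_ : ∀ {n} (x y : Vec ℕ n) → Dec (x ≤v y)
x ≤v? y = PW.decidable _≤?_ x y

_∨v_ : ∀ {n} → Vec ℕ n → Vec ℕ n → Vec ℕ n
x ∨v y = zipWith _⊔_ x y

InSpace : ∀ {n} → Vec ℕ n → Vec ℕ n → Set
InSpace m x = x ≤v m

states : ∀ {n} → Vec ℕ n → List (Vec ℕ n)
states [] = [] ∷ []
states (mi ∷ m) = concatMap (λ a → map (a ∷_) (states m)) (upTo (suc mi))

-- Multistate monotone system: structure function φ with values in {0..M},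
-- non-decreasing on the state space.  (Only values of φ on 𝔠(m) matter.)

record IsMMS {n : ℕ} (m : Vec ℕ n) (M : ℕ) (φ : Vec ℕ n → ℕ) : Set where
  field
    bounded  : ∀ x → InSpace m x → φ x ≤ M
    monotone : ∀ x y → InSpace m x → InSpace m y → x ≤v y → φ x ≤ φ y

φlevel : ∀ {n} → (Vec ℕ n → ℕ) → ℕ → Vec ℕ n → ℤ
φlevel φ k x with k ≤? φ x
... | yes _ = + 1
... | no  _ = + 0

IsMinPath : ∀ {n} → Vec ℕ n → (Vec ℕ n → ℕ) → ℕ → Vec ℕ n → Set
IsMinPath m φ k x =
  InSpace m x × (k ≤ φ x) × All (λ y → y ≤v x → y ≢ x → φ y < k) (states m)

isMinPath? : ∀ {n} (m : Vec ℕ n) (φ : Vec ℕ n → ℕ) (k : ℕ) (x : Vec ℕ n) →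
             Dec (IsMinPath m φ k x)
isMinPath? m φ k x =
  (x ≤v? m) ×-dec ((k ≤? φ x) ×-dec
    all? (λ y → (y ≤v? x) →-dec ((¬? (≡-dec ℕ._≟_ y x)) →-dec (φ y <? k))) (states m))

minPaths : ∀ {n} → Vec ℕ n → (Vec ℕ n → ℕ) → ℕ → List (Vec ℕ n)
minPaths m φ k = filter (isMinPath? m φ k) (states m)

-- Closure and signed domination of a finite set 𝔛 (given as a
-- repetition-free list of vectors of length n)

-- all sublists (= all subsets, as 𝔛 has no repetitions)
subsets : ∀ {a} {A : Set a} → List A → List (List A)
subsets [] = [] ∷ []
subsets (x ∷ xs) = let s = subsets xs in map (x ∷_) s L.++ s

-- join of a list of vectors (the zero vector is neutral for ∨ on ℕⁿ)
joinAll : ∀ {n} → List (Vec ℕ n) → Vec ℕ n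
joinAll {n} = foldr _∨v_ (replicate n 0)

NonEmpty : ∀ {a} {A : Set a} → List A → Set
NonEmpty xs = 1 ≤ length xs

data Cl {n : ℕ} (𝔛 : List (Vec ℕ n)) : Vec ℕ n → Set where
  base : ∀ {x} → x ∈ 𝔛 → Cl 𝔛 x
  join : ∀ {x y} → Cl 𝔛 x → Cl 𝔛 y → Cl 𝔛 (x ∨v y)

clList : ∀ {n} → List (Vec ℕ n) → List (Vec ℕ n)
clList 𝔛 =
  deduplicate (≡-dec ℕ._≟_)
    (map joinAll (filter (λ S → 1 ≤? length S) (subsets 𝔛)))

formations : ∀ {n} → List (Vec ℕ n) → Vec ℕ n → List (List (Vec ℕ n))
formations 𝔛 x =
  filter (λ S → (1 ≤? length S) ×-dec ≡-dec ℕ._≟_ (joinAll S) x) (subsets 𝔛)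

Odd : ℕ → Set
Odd j = ℕ._%_ j 2 ≡ 1

odd? : (j : ℕ) → Dec (Odd j)
odd? j = ℕ._≟_ (ℕ._%_ j 2) 1

oddFormations evenFormations : ∀ {n} → List (Vec ℕ n) → Vec ℕ n → List (List (Vec ℕ n))
oddFormations  𝔛 x = filter (λ S → odd? (length S)) (formations 𝔛 x)
evenFormations 𝔛 x = filter (λ S → ¬? (odd? (length S))) (formations 𝔛 x)

δ : ∀ {n} → List (Vec ℕ n) → Vec ℕ n → ℤ
δ 𝔛 x = (+ length (oddFormations 𝔛 x)) ℤ.- (+ length (evenFormations 𝔛 x))

sumδBelow : ∀ {n} → List (Vec ℕ n) → Vec ℕ n → ℤ
sumδBelow 𝔛 y = foldr ℤ._+_ (+ 0) (map (δ 𝔛) (filter (λ x → x ≤v? y) (clList 𝔛)))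

-- Every y in cl(𝔓ₖ) dominates some minimal path vector p, so φ(y) ≥ φ(p) ≥ k and the
-- left-hand side is 1.  Expanding δₖ over formations, the right-hand side becomes a sum
-- over the nonempty subsets S ⊆ 𝔓ₖ with ∨S ≤ y, i.e. over the nonempty subsets of
-- 𝔓ₖ(y) = {p ∈ 𝔓ₖ | p ≤ y}, of (−1)^(|S|+1).  As 𝔓ₖ(y) is nonempty, the alternating sum
-- of (−1)^|S| over all its subsets vanishes, and removing the empty subset leaves 1.
module Submission where

open import Defs
open import Data.Nat using (ℕ; _≤_)
open import Data.Vec using (Vec)
open import Relation.Binary.PropositionalEquality using (_≡_)

open import Data.Bool using (Bool; true; false; _∧_)
open import Data.Nat as ℕ using (suc; z≤n; _≤?_)
import Data.Nat.Properties as ℕ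
open import Data.Integer using (ℤ; +_; -_; _+_; _-_; -1ℤ)
import Data.Integer.Properties as ℤ
open import Data.Integer.Tactic.RingSolver using (solve-∀)
open import Data.Vec using ([]; _∷_; replicate)
open import Data.Vec.Properties using (≡-dec)
open import Data.Vec.Relation.Binary.Pointwise.Inductive as PW using ([]; _∷_)
open import Data.List using (List; []; _∷_; map; filter; foldr; length; _++_)
open import Data.List.Relation.Unary.All as All using (All; []; _∷_; all?)
open import Data.List.Relation.Unary.Any using (Any; here; there)
open import Data.List.Relation.Unary.Unique.Propositional using (Unique)
open import Data.List.Relation.Unary.AllPairs using (_∷_)
import Data.List.Relation.Unary.Unique.DecPropositional.Properties as Unique
open import Data.List.Membership.Propositional using (_∈_; lose)
open import Data.List.Membership.Propositional.Properties
  using (∈-filter⁺; ∈-filter⁻; ∈-map⁺; ∈-deduplicate⁺)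
open import Data.Product using (∃-syntax; _×_; _,_; proj₁; proj₂)
open import Data.Empty using (⊥-elim)
open import Function using (_∘_; _⇔_; mk⇔)
open import Relation.Binary.PropositionalEquality
  using (refl; sym; trans; cong; cong₂; module ≡-Reasoning)
open import Relation.Nullary using (Dec; yes; no; does; ¬?; _×-dec_)
open import Relation.Nullary.Decidable using (dec-true; dec-false; does-⇔)

private
  variable
    A B : Set

infixr 7 [_]·_
[_]·_ : Bool → ℤ → ℤ
[ true  ]· z = z
[ false ]· z = + 0

[]·-∧ : ∀ a b z → [ a ∧ b ]· z ≡ [ a ]· [ b ]· z
[]·-∧ true  b z = refl
[]·-∧ false b z = refl

[]·-comm : ∀ a b z → [ a ]· [ b ]· z ≡ [ b ]· [ a ]· z
[]·-comm true  true  z = refl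
[]·-comm true  false z = refl
[]·-comm false true  z = refl
[]·-comm false false z = refl

[]·-neg : ∀ b z → [ b ]· (- z) ≡ - ([ b ]· z)
[]·-neg true  z = refl
[]·-neg false z = refl

[]·-zero : ∀ b → [ b ]· + 0 ≡ + 0
[]·-zero true  = refl
[]·-zero false = refl

∑ : List A → (A → ℤ) → ℤ
∑ xs f = foldr _+_ (+ 0) (map f xs)

infix 5 ∑
syntax ∑ xs (λ x → e) = ∑[ x ← xs ] e

∑-cong : {f g : A → ℤ} (xs : List A) → (∀ {x} → x ∈ xs → f x ≡ g x) → ∑ xs f ≡ ∑ xs g
∑-cong []       f≡g = refl
∑-cong (x ∷ xs) f≡g = cong₂ _+_ (f≡g (here refl)) (∑-cong xs (f≡g ∘ there))

∑-zero : {f : A → ℤ} (xs : List A) → (∀ {x} → x ∈ xs → f x ≡ + 0) → ∑ xs f ≡ + 0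
∑-zero []       f≡0 = refl
∑-zero (x ∷ xs) f≡0 = cong₂ _+_ (f≡0 (here refl)) (∑-zero xs (f≡0 ∘ there))

∑-++ : (xs ys : List A) (f : A → ℤ) → ∑ (xs ++ ys) f ≡ ∑ xs f + ∑ ys f
∑-++ []       ys f = sym (ℤ.+-identityˡ _)
∑-++ (x ∷ xs) ys f = trans (cong (_+_ (f x)) (∑-++ xs ys f)) (sym (ℤ.+-assoc (f x) _ _))

∑-map : (g : A → B) (xs : List A) (f : B → ℤ) → ∑ (map g xs) f ≡ ∑ xs (f ∘ g)
∑-map g []       f = refl
∑-map g (x ∷ xs) f = cong (_+_ (f (g x))) (∑-map g xs f)

∑-+ : (xs : List A) (f g : A → ℤ) → ∑[ x ← xs ] (f x + g x) ≡ ∑ xs f + ∑ xs g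
∑-+ []       f g = refl
∑-+ (x ∷ xs) f g = trans (cong (_+_ (f x + g x)) (∑-+ xs f g)) (interchange (f x) (g x) _ _)
  where
  interchange : ∀ a b c d → a + b + (c + d) ≡ a + c + (b + d)
  interchange = solve-∀

∑-neg : (xs : List A) (f : A → ℤ) → ∑[ x ← xs ] (- f x) ≡ - ∑ xs f
∑-neg []       f = refl
∑-neg (x ∷ xs) f = trans (cong (_+_ (- f x)) (∑-neg xs f)) (sym (ℤ.neg-distrib-+ (f x) _))

∑-[]· : (b : Bool) (xs : List A) (f : A → ℤ) → ∑[ x ← xs ] [ b ]· f x ≡ [ b ]· ∑ xs f
∑-[]· true  xs f = refl
∑-[]· false xs f = ∑-zero xs (λ _ → refl)

∑-filter : ∀ {p} {P : A → Set p} (P? : ∀ x → Dec (P x)) (xs : List A) (f : A → ℤ) →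
           ∑ (filter P? xs) f ≡ ∑[ x ← xs ] [ does (P? x) ]· f x
∑-filter P? []       f = refl
∑-filter P? (x ∷ xs) f with does (P? x)
... | true  = cong (_+_ (f x)) (∑-filter P? xs f)
... | false = trans (∑-filter P? xs f) (sym (ℤ.+-identityˡ _))

∑-comm : (xs : List A) (ys : List B) (f : A → B → ℤ) →
         ∑[ x ← xs ] ∑[ y ← ys ] f x y ≡ ∑[ y ← ys ] ∑[ x ← xs ] f x y
∑-comm []       ys f = sym (∑-zero ys (λ _ → refl))
∑-comm (x ∷ xs) ys f =
  trans (cong (_+_ (∑ ys (f x))) (∑-comm xs ys f)) (sym (∑-+ ys (f x) (λ y → ∑[ x ← xs ] f x y)))

∑-select : (_≟_ : (a b : A) → Dec (a ≡ b)) {a : A} {xs : List A} → Unique xs → a ∈ xs →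
           (f : A → ℤ) → ∑[ x ← xs ] [ does (a ≟ x) ]· f x ≡ f a
∑-select _≟_ {a} (a∉xs ∷ _) (here refl) f rewrite dec-true (a ≟ a) refl =
  trans (cong (_+_ (f a)) (∑-zero _ (λ x∈xs → cong ([_]· _) (dec-false (a ≟ _) (All.lookup a∉xs x∈xs)))))
        (ℤ.+-identityʳ (f a))
∑-select _≟_ {a} {x ∷ _} (x∉xs ∷ xs!) (there a∈xs) f
  rewrite dec-false (a ≟ x) (λ a≡x → All.lookup x∉xs a∈xs (sym a≡x)) =
  trans (ℤ.+-identityˡ _) (∑-select _≟_ xs! a∈xs f)

signOf : Bool → ℤ
signOf true  = + 1
signOf false = -1ℤ

+[1+a]-b : ∀ a b → + suc a - + b ≡ + 1 + (+ a - + b)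
+[1+a]-b a b = trans (cong (_- + b) (ℤ.pos-+ 1 a)) (ℤ.+-assoc (+ 1) (+ a) (- + b))

+a-[1+b] : ∀ a b → + a - + suc b ≡ -1ℤ + (+ a - + b)
+a-[1+b] a b = trans (cong (_-_ (+ a)) (ℤ.pos-+ 1 b)) (rearrange (+ a) (+ b))
  where
  rearrange : ∀ a b → a - (+ 1 + b) ≡ -1ℤ + (a - b)
  rearrange = solve-∀

filter-length-difference : ∀ {p} {P : A → Set p} (P? : ∀ x → Dec (P x)) (xs : List A) →
  + length (filter P? xs) - + length (filter (λ x → ¬? (P? x)) xs)
    ≡ ∑[ x ← xs ] signOf (does (P? x))
filter-length-difference P? []       = refl
filter-length-difference P? (x ∷ xs) with does (P? x)
... | true  = trans (+[1+a]-b _ (length (filter (λ x → ¬? (P? x)) xs)))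
                    (cong (_+_ (+ 1)) (filter-length-difference P? xs))
... | false = trans (+a-[1+b] (length (filter P? xs)) _)
                    (cong (_+_ -1ℤ) (filter-length-difference P? xs))

∑-subsets-∷ : (x : A) (xs : List A) (f : List A → ℤ) →
              ∑ (subsets (x ∷ xs)) f ≡ (∑[ S ← subsets xs ] f (x ∷ S)) + ∑ (subsets xs) f
∑-subsets-∷ x xs f =
  trans (∑-++ (map (x ∷_) (subsets xs)) (subsets xs) f)
        (cong (_+ ∑ (subsets xs) f) (∑-map (x ∷_) (subsets xs) f))

nonempty? : (S : List A) → Dec (NonEmpty S)
nonempty? S = 1 ≤? length S

∑-subsets-nonempty : (xs : List A) (f : List A → ℤ) →
                     ∑[ S ← subsets xs ] [ does (nonempty? S) ]· f S ≡ ∑ (subsets xs) f - f []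
∑-subsets-nonempty [] f =
  sym (trans (cong (_- f []) (ℤ.+-identityʳ (f []))) (ℤ.+-inverseʳ (f [])))
∑-subsets-nonempty (x ∷ xs) f = begin
  ∑[ S ← subsets (x ∷ xs) ] [ does (nonempty? S) ]· f S
    ≡⟨ ∑-subsets-∷ x xs _ ⟩
  (∑[ S ← subsets xs ] f (x ∷ S)) + (∑[ S ← subsets xs ] [ does (nonempty? S) ]· f S)
    ≡⟨ cong (_+_ (∑[ S ← subsets xs ] f (x ∷ S))) (∑-subsets-nonempty xs f) ⟩
  (∑[ S ← subsets xs ] f (x ∷ S)) + (∑ (subsets xs) f - f [])
    ≡⟨ sym (ℤ.+-assoc (∑[ S ← subsets xs ] f (x ∷ S)) (∑ (subsets xs) f) (- f [])) ⟩
  (∑[ S ← subsets xs ] f (x ∷ S)) + ∑ (subsets xs) f - f []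
    ≡⟨ cong (_- f []) (sym (∑-subsets-∷ x xs f)) ⟩
  ∑ (subsets (x ∷ xs)) f - f [] ∎
  where open ≡-Reasoning

oddSign : ℕ → ℤ
oddSign j = signOf (does (odd? j))

oddSign-suc : ∀ j → oddSign (suc j) ≡ - oddSign j
oddSign-suc 0             = refl
oddSign-suc 1             = refl
oddSign-suc (suc (suc j)) = oddSign-suc j

module _ {p} {P : A → Set p} (P? : ∀ x → Dec (P x)) where

  alternatingSum : List A → ℤ
  alternatingSum xs = ∑[ S ← subsets xs ] [ does (all? P? S) ]· oddSign (length S)

  alternatingSum-∷ : ∀ x xs →
    alternatingSum (x ∷ xs) ≡ [ does (P? x) ]· (- alternatingSum xs) + alternatingSum xs
  alternatingSum-∷ x xs = trans (∑-subsets-∷ x xs _) (cong (_+ alternatingSum xs) (begin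
    ∑[ S ← subsets xs ] [ does (P? x) ∧ does (all? P? S) ]· oddSign (suc (length S))
      ≡⟨ ∑-cong (subsets xs) (λ {S} _ → prepend (does (all? P? S)) (length S)) ⟩
    ∑[ S ← subsets xs ] [ does (P? x) ]· (- ([ does (all? P? S) ]· oddSign (length S)))
      ≡⟨ ∑-[]· (does (P? x)) (subsets xs) _ ⟩
    [ does (P? x) ]· (∑[ S ← subsets xs ] - ([ does (all? P? S) ]· oddSign (length S)))
      ≡⟨ cong ([ does (P? x) ]·_) (∑-neg (subsets xs) _) ⟩
    [ does (P? x) ]· (- alternatingSum xs) ∎))
    where
    open ≡-Reasoning
    prepend : ∀ b j → [ does (P? x) ∧ b ]· oddSign (suc j) ≡ [ does (P? x) ]· (- ([ b ]· oddSign j))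
    prepend b j = begin
      [ does (P? x) ∧ b ]· oddSign (suc j)
        ≡⟨ []·-∧ (does (P? x)) b _ ⟩
      [ does (P? x) ]· [ b ]· oddSign (suc j)
        ≡⟨ cong (λ z → [ does (P? x) ]· [ b ]· z) (oddSign-suc j) ⟩
      [ does (P? x) ]· [ b ]· (- oddSign j)
        ≡⟨ cong ([ does (P? x) ]·_) ([]·-neg b (oddSign j)) ⟩
      [ does (P? x) ]· (- ([ b ]· oddSign j)) ∎

  -- Adding a witness of P to a subset or removing it flips the sign, so the terms cancel in pairs.
  alternatingSum-Any : ∀ {xs} → Any P xs → alternatingSum xs ≡ + 0
  alternatingSum-Any {x ∷ xs} (here px)
    rewrite alternatingSum-∷ x xs | dec-true (P? x) px = ℤ.+-inverseˡ (alternatingSum xs)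
  alternatingSum-Any {x ∷ xs} (there any)
    rewrite alternatingSum-∷ x xs | alternatingSum-Any any =
    trans (ℤ.+-identityʳ _) ([]·-zero (does (P? x)))

∨v-upperˡ : ∀ {n} (x z : Vec ℕ n) → x ≤v (x ∨v z)
∨v-upperˡ []      []      = []
∨v-upperˡ (a ∷ x) (b ∷ z) = ℕ.m≤m⊔n a b ∷ ∨v-upperˡ x z

∨v-upperʳ : ∀ {n} (x z : Vec ℕ n) → z ≤v (x ∨v z)
∨v-upperʳ []      []      = []
∨v-upperʳ (a ∷ x) (b ∷ z) = ℕ.m≤n⊔m a b ∷ ∨v-upperʳ x z

∨v-lub : ∀ {n} {x z y : Vec ℕ n} → x ≤v y → z ≤v y → (x ∨v z) ≤v y
∨v-lub []       []       = []
∨v-lub (p ∷ ps) (q ∷ qs) = ℕ.⊔-lub p q ∷ ∨v-lub ps qs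

zero≤v : ∀ {n} (y : Vec ℕ n) → replicate n 0 ≤v y
zero≤v []      = []
zero≤v (_ ∷ y) = z≤n ∷ zero≤v y

joinAll≤v⇔All : ∀ {n} (S : List (Vec ℕ n)) (y : Vec ℕ n) → joinAll S ≤v y ⇔ All (_≤v y) S
joinAll≤v⇔All S y = mk⇔ (to S) (from S)
  where
  to : ∀ S → joinAll S ≤v y → All (_≤v y) S
  to []      _     = []
  to (x ∷ S) ∨S≤y = PW.trans ℕ.≤-trans (∨v-upperˡ x (joinAll S)) ∨S≤y
                  ∷ to S (PW.trans ℕ.≤-trans (∨v-upperʳ x (joinAll S)) ∨S≤y)
  from : ∀ S → All (_≤v y) S → joinAll S ≤v y
  from []      []         = zero≤v y
  from (x ∷ S) (x≤y ∷ S≤y) = ∨v-lub x≤y (from S S≤y)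

module _ {n} {𝔛 : List (Vec ℕ n)} where

  Cl-dominates : ∀ {y} → Cl 𝔛 y → ∃[ x ] (x ∈ 𝔛 × x ≤v y)
  Cl-dominates (base {x} x∈𝔛) = x , x∈𝔛 , PW.refl ℕ.≤-refl
  Cl-dominates (join {x} {z} x∈cl _) =
    let w , w∈𝔛 , w≤x = Cl-dominates x∈cl in w , w∈𝔛 , PW.trans ℕ.≤-trans w≤x (∨v-upperˡ x z)

  Cl-bounded : ∀ {m y} → (∀ {x} → x ∈ 𝔛 → x ≤v m) → Cl 𝔛 y → y ≤v m
  Cl-bounded 𝔛≤m (base x∈𝔛)     = 𝔛≤m x∈𝔛
  Cl-bounded 𝔛≤m (join x∈cl z∈cl) = ∨v-lub (Cl-bounded 𝔛≤m x∈cl) (Cl-bounded 𝔛≤m z∈cl)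

_≟v_ : ∀ {n} (x z : Vec ℕ n) → Dec (x ≡ z)
_≟v_ = ≡-dec ℕ._≟_

module _ {n} (𝔛 : List (Vec ℕ n)) where

  isFormation? : (x : Vec ℕ n) (S : List (Vec ℕ n)) → Dec (NonEmpty S × joinAll S ≡ x)
  isFormation? x S = nonempty? S ×-dec (joinAll S ≟v x)

  δ-expansion : ∀ x → δ 𝔛 x ≡ ∑[ S ← subsets 𝔛 ] [ does (isFormation? x S) ]· oddSign (length S)
  δ-expansion x = trans (filter-length-difference (λ S → odd? (length S)) (formations 𝔛 x))
                        (∑-filter (isFormation? x) (subsets 𝔛) (λ S → oddSign (length S)))

  joinAll∈clList : ∀ {S} → S ∈ subsets 𝔛 → NonEmpty S → joinAll S ∈ clList 𝔛
  joinAll∈clList S∈ S≢[] = ∈-deduplicate⁺ _≟v_ (∈-map⁺ joinAll (∈-filter⁺ nonempty? S∈ S≢[]))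

  module _ (y : Vec ℕ n) where

    -- Each nonempty S ⊆ 𝔛 is a formation of exactly one element of cl(𝔛), namely ∨S.
    ∑-formations-below : ∀ {S} → S ∈ subsets 𝔛 →
      (∑[ x ← clList 𝔛 ] [ does (x ≤v? y) ]· [ does (isFormation? x S) ]· oddSign (length S))
        ≡ [ does (nonempty? S) ]· [ does (all? (_≤v? y) S) ]· oddSign (length S)
    ∑-formations-below {S} S∈ = begin
      (∑[ x ← clList 𝔛 ] [ does (x ≤v? y) ]· [ does (isFormation? x S) ]· σ)
        ≡⟨ ∑-cong (clList 𝔛) (λ {x} _ →
             reorder (does (nonempty? S)) (does (joinAll S ≟v x)) (does (x ≤v? y))) ⟩
      (∑[ x ← clList 𝔛 ] [ does (nonempty? S) ]· [ does (joinAll S ≟v x) ]· [ does (x ≤v? y) ]· σ)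
        ≡⟨ ∑-[]· (does (nonempty? S)) (clList 𝔛) _ ⟩
      [ does (nonempty? S) ]· (∑[ x ← clList 𝔛 ] [ does (joinAll S ≟v x) ]· [ does (x ≤v? y) ]· σ)
        ≡⟨ select (nonempty? S) ⟩
      [ does (nonempty? S) ]· [ does (all? (_≤v? y) S) ]· σ ∎
      where
      open ≡-Reasoning
      σ = oddSign (length S)
      reorder : ∀ a b c → [ c ]· [ a ∧ b ]· σ ≡ [ a ]· [ b ]· [ c ]· σ
      reorder a b c = trans (cong ([ c ]·_) ([]·-∧ a b σ))
                     (trans ([]·-comm c a _) (cong ([ a ]·_) ([]·-comm c b σ)))
      select : (ne? : Dec (NonEmpty S)) →
        [ does ne? ]· (∑[ x ← clList 𝔛 ] [ does (joinAll S ≟v x) ]· [ does (x ≤v? y) ]· σ)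
          ≡ [ does ne? ]· [ does (all? (_≤v? y) S) ]· σ
      select (no _)      = refl
      select (yes S≢[]) =
        trans (∑-select _≟v_ (Unique.deduplicate-! _≟v_ _) (joinAll∈clList S∈ S≢[])
                        (λ x → [ does (x ≤v? y) ]· σ))
              (cong ([_]· σ) (does-⇔ (joinAll≤v⇔All S y) (joinAll S ≤v? y) (all? (_≤v? y) S)))

    sumδBelow-dominated : Any (_≤v y) 𝔛 → sumδBelow 𝔛 y ≡ + 1
    sumδBelow-dominated dominated = begin
      sumδBelow 𝔛 y
        ≡⟨ ∑-filter (_≤v? y) (clList 𝔛) (δ 𝔛) ⟩
      (∑[ x ← clList 𝔛 ] [ does (x ≤v? y) ]· δ 𝔛 x)
        ≡⟨ ∑-cong (clList 𝔛) (λ {x} _ → trans (cong ([ does (x ≤v? y) ]·_) (δ-expansion x))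
                                               (sym (∑-[]· (does (x ≤v? y)) (subsets 𝔛) _))) ⟩
      (∑[ x ← clList 𝔛 ] ∑[ S ← subsets 𝔛 ]
         [ does (x ≤v? y) ]· [ does (isFormation? x S) ]· oddSign (length S))
        ≡⟨ ∑-comm (clList 𝔛) (subsets 𝔛) _ ⟩
      (∑[ S ← subsets 𝔛 ] ∑[ x ← clList 𝔛 ]
         [ does (x ≤v? y) ]· [ does (isFormation? x S) ]· oddSign (length S))
        ≡⟨ ∑-cong (subsets 𝔛) ∑-formations-below ⟩
      (∑[ S ← subsets 𝔛 ] [ does (nonempty? S) ]· [ does (all? (_≤v? y) S) ]· oddSign (length S))
        ≡⟨ ∑-subsets-nonempty 𝔛 _ ⟩
      alternatingSum (_≤v? y) 𝔛 - -1ℤ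
        ≡⟨ cong (_- -1ℤ) (alternatingSum-Any (_≤v? y) dominated) ⟩
      + 1 ∎
      where open ≡-Reasoning

φlevel-≥ : ∀ {n} (φ : Vec ℕ n → ℕ) {k} {y} → k ≤ φ y → φlevel φ k y ≡ + 1
φlevel-≥ φ {k} {y} k≤φy with k ≤? φ y
... | yes _    = refl
... | no  k≰φy = ⊥-elim (k≰φy k≤φy)

minPath-sound : ∀ {n} (m : Vec ℕ n) φ k {x} → x ∈ minPaths m φ k → InSpace m x × k ≤ φ x
minPath-sound m φ k x∈𝔓 =
  let _ , x∈m , k≤φx , _ = ∈-filter⁻ (isMinPath? m φ k) {xs = states m} x∈𝔓 in x∈m , k≤φx

corollary3p3 : (n : ℕ) (m : Vec ℕ n) (M : ℕ) (φ : Vec ℕ n → ℕ) → IsMMS m M φ →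
    (k : ℕ) → 1 ≤ k → k ≤ M →
    (y : Vec ℕ n) → Cl (minPaths m φ k) y →
    φlevel φ k y ≡ sumδBelow (minPaths m φ k) y
corollary3p3 n m M φ mms k _ _ y y∈cl with Cl-dominates y∈cl
... | p , p∈𝔓 , p≤y = begin
  φlevel φ k y                 ≡⟨ φlevel-≥ φ (ℕ.≤-trans k≤φp φp≤φy) ⟩
  + 1                          ≡⟨ sym (sumδBelow-dominated (minPaths m φ k) y (lose p∈𝔓 p≤y)) ⟩
  sumδBelow (minPaths m φ k) y ∎
  where
  open ≡-Reasoning
  p∈m : InSpace m p
  p∈m = proj₁ (minPath-sound m φ k p∈𝔓)
  k≤φp : k ≤ φ p
  k≤φp = proj₂ (minPath-sound m φ k p∈𝔓)
  y∈m : InSpace m y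
  y∈m = Cl-bounded (proj₁ ∘ minPath-sound m φ k) y∈cl
  φp≤φy : φ p ≤ φ y
  φp≤φy = IsMMS.monotone mms p y p∈m y∈m p≤y
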